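{- Let $r,x$ be complex numbers. Then, as formal power series in $t$, $$\sum_{n=0}^{\infty}D_n^{(r)}(x)\frac{t^n}{n!}=(1+t^2)^{ -r-\frac12}\, e^{x\arctan t},$$ where $\arctan t=\sum_{k\ge0}(-1)^k t^{2k+1}/(2k+1)$ and $(1+t^2)^{ -r-\frac12}=\sum_{k\ge0}\binom{ -r-\frac12}{k}t^{2k}$.
   Context: For a complex number $a$ and integer $k\ge0$, $\binom{a}{k}=a(a-1)\cdots(a-k+1)/k!$. The polynomials $D_n^{(r)}(x)$ are defined by $D_{ -1}^{(r)}(x)=0$, $D_0^{(r)}(x)=1$ and $D_{n+1}^{(r)}(x)=xD_n^{(r)}(x)-n(n+2r)D_{n-1}^{(r)}(x)$ for $n\ge0$. -}

module Defs where

open import Level using (Level)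
open import Data.Nat using (ℕ; zero; suc)
open import Algebra.Bundles using (CommutativeRing)
import Data.Nat.Properties as ℕP
open import Relation.Binary.PropositionalEquality using (subst; cong)
open import Data.Product using (_×_; _,_; proj₂)

-- Everything is developed over a commutative ring R in which every
-- positive integer n+1 has a (chosen) inverse  inv n  (a Q-algebra);
-- the complex numbers are such a ring.
module Series {c ℓ : Level} (R : CommutativeRing c ℓ) (inv : ℕ → CommutativeRing.Carrier R) where
  open CommutativeRing R hiding (zero)

  ι : ℕ → Carrier
  ι zero = 0#
  ι (suc n) = 1# + ι n

  -- the inverse of a positive integer: recip (suc n) = 1/(n+1) (recip 0 unused, set to 0)
  recip : ℕ → Carrier
  recip zero = 0#
  recip (suc n) = inv n

  invFact : ℕ → Carrier
  invFact zero = 1#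
  invFact (suc n) = recip (suc n) * invFact n

  pow : Carrier → ℕ → Carrier
  pow a zero = 1#
  pow a (suc n) = a * pow a n

  sumTo : ℕ → (ℕ → Carrier) → Carrier
  sumTo zero f = 0#
  sumTo (suc n) f = sumTo n f + f n

  fallingFact : Carrier → ℕ → Carrier
  fallingFact a zero = 1#
  fallingFact a (suc k) = fallingFact a k * (a - ι k)

  binom : Carrier → ℕ → Carrier
  binom a k = fallingFact a k * invFact k

  -- the polynomials D_n^{(r)}(x), defined literally by the recurrence
  -- D_{-1} = 0, D_0 = 1, D_{n+1} = x D_n - n(n+2r) D_{n-1}  (n ≥ 0).
  -- Dpair r x n = (D_{n-1}, D_n).
  Dpair : Carrier → Carrier → ℕ → Carrier × Carrier
  Dpair r x zero = 0# , 1#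
  Dpair r x (suc n) with Dpair r x n
  ... | (dprev , dn) = dn , (x * dn - ι n * (ι n + (r + r)) * dprev)

  D : Carrier → Carrier → ℕ → Carrier
  D r x n = proj₂ (Dpair r x n)

  PS : Set c
  PS = ℕ → Carrier

  _·_ : PS → PS → PS
  (A · B) n = sumTo (suc n) (λ i → A i * B (n Data.Nat.∸ i))

  psPow : PS → ℕ → PS
  psPow A zero zero = 1#
  psPow A zero (suc n) = 0#
  psPow A (suc m) = A · psPow A m

  -- exp(a·A(t)) for a series A with zero constant term:
  -- Σ_m a^m A(t)^m / m!, whose t^n-coefficient only involves m ≤ n
  expS : Carrier → PS → PS
  expS a A n = sumTo (suc n) (λ m → pow a m * invFact m * psPow A m n)

  data Parity : ℕ → Set where
    even : (k : ℕ) → Parity (k Data.Nat.+ k)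
    odd  : (k : ℕ) → Parity (suc (k Data.Nat.+ k))

  parity : (n : ℕ) → Parity n
  parity zero = even zero
  parity (suc n) with parity n
  ... | even k = odd k
  ... | odd k = subst Parity (cong suc (ℕP.+-suc k k)) (even (suc k))

  arctanCoeff : (n : ℕ) → Parity n → Carrier
  arctanCoeff _ (even k) = 0#
  arctanCoeff _ (odd k) = pow (- 1#) k * recip (suc (k Data.Nat.+ k))

  arctanS : PS
  arctanS n = arctanCoeff n (parity n)

  binCoeff : Carrier → (n : ℕ) → Parity n → Carrier
  binCoeff a _ (even k) = binom a k
  binCoeff a _ (odd k) = 0#

  onePlusTSqPow : Carrier → PS
  onePlusTSqPow a n = binCoeff a n (parity n)

  half : Carrier
  half = recip 2

  egfD : Carrier → Carrier → PS
  egfD r x n = D r x n * invFact n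

  rhs : Carrier → Carrier → PS
  rhs r x = onePlusTSqPow (- r - half) · expS x arctanS

-- Write δ = (1 + t²) d/dt.  It is a derivation with δ(arctan t) = 1, hence
-- δ(e^{x arctan t}) = x e^{x arctan t}, while δ((1 + t²)^a) = 2a t (1 + t²)^a.  So
-- G = (1 + t²)^a e^{x arctan t} with a = -r - 1/2 solves δG = (2a t + x) G.  On the
-- coefficients g_n = d_n / n! this equation reads d_{n+2} = x d_{n+1} - (n+1)(n+1+2r) d_n,
-- the recurrence defining D_n^{(r)}(x); as every n + 1 is invertible, a solution of
-- δG = (2a t + x) G is determined by G(0) = 1.

module Submission where

open import Defs
open import Data.Nat using (ℕ; suc)
open import Algebra.Bundles using (CommutativeRing)

open import Data.Nat as ℕ
  using (zero; _≤_; _<_; _≤′_; ≤′-refl; ≤′-step; ⌊_/2⌋; ⌈_/2⌉)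
import Data.Nat.Properties as ℕP
open import Data.Integer as ℤ using (ℤ; +_; -[1+_]; _⊖_)
import Data.Integer.Properties as ℤP
open import Data.Sign as Sign using (Sign)
open import Data.Maybe using (Maybe; just; nothing)
open import Data.Empty using (⊥-elim)
open import Data.Product using (_×_; _,_; proj₁)
open import Relation.Nullary using (yes; no)
open import Relation.Binary.PropositionalEquality as ≡ using (_≡_; _≢_; subst)
open import Algebra.Solver.Ring.AlmostCommutativeRing
  using (fromCommutativeRing; _-Raw-AlmostCommutative⟶_)
import Algebra.Solver.Ring

double-injective : ∀ {j k} → j ℕ.+ j ≡ k ℕ.+ k → j ≡ k
double-injective {j} {k} e =
  ≡.trans (ℕP.n≡⌊n+n/2⌋ j) (≡.trans (≡.cong ⌊_/2⌋ e) (≡.sym (ℕP.n≡⌊n+n/2⌋ k)))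

even≢odd : ∀ j k → j ℕ.+ j ≢ suc (k ℕ.+ k)
even≢odd j k e = ℕP.1+n≢n (≡.trans (≡.sym j≡1+k) j≡k)
  where
  j≡k : j ≡ k
  j≡k = ≡.trans (ℕP.n≡⌊n+n/2⌋ j) (≡.trans (≡.cong ⌊_/2⌋ e) (≡.sym (ℕP.n≡⌈n+n/2⌉ k)))
  j≡1+k : j ≡ suc k
  j≡1+k = ≡.trans (ℕP.n≡⌈n+n/2⌉ j)
                  (≡.trans (≡.cong ⌈_/2⌉ e) (≡.cong suc (≡.sym (ℕP.n≡⌊n+n/2⌋ k))))

module IntegerCoefficientRingSolver {c ℓ} (R : CommutativeRing c ℓ) where
  open CommutativeRing R
  open import Relation.Binary.Reasoning.Setoid setoid
  open import Algebra.Properties.Ring ring using (-1*x≈-x; -‿involutive; -0#≈0#)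
  open import Algebra.Properties.AbelianGroup +-abelianGroup using (⁻¹-∙-comm)
  open import Algebra.Properties.CommutativeSemigroup +-commutativeSemigroup
    using () renaming (interchange to +-interchange)
  open import Algebra.Properties.CommutativeSemigroup *-commutativeSemigroup
    using () renaming (interchange to *-interchange)
  -- Here 1 ×′ x = x holds by definition, so the solver's constant 1 is literally 1#.
  open import Algebra.Properties.Semiring.Mult.TCOptimised semiring
    using (1+×; ×-homo-+; ×1-homo-*) renaming (_×_ to _×′_)

  ⟦_⟧ : ℤ → Carrier
  ⟦ + n ⟧ = n ×′ 1#
  ⟦ -[1+ n ] ⟧ = - (suc n ×′ 1#)

  ⟦_⟧ₛ : Sign → Carrier
  ⟦ Sign.+ ⟧ₛ = 1#
  ⟦ Sign.- ⟧ₛ = - 1#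

  private
    x≈0+x : ∀ x → x ≈ 0# + x
    x≈0+x x = sym (+-identityˡ x)

    x≈x-0 : ∀ x → x ≈ x - 0#
    x≈x-0 x = sym (trans (+-congˡ -0#≈0#) (+-identityʳ x))

    [1+x]-[1+y]≈x-y : ∀ x y → (1# + x) - (1# + y) ≈ x - y
    [1+x]-[1+y]≈x-y x y = begin
      (1# + x) + - (1# + y)   ≈⟨ +-congˡ (⁻¹-∙-comm 1# y) ⟨
      (1# + x) + (- 1# + - y) ≈⟨ +-interchange 1# x (- 1#) (- y) ⟩
      (1# - 1#) + (x - y)     ≈⟨ +-congʳ (-‿inverseʳ 1#) ⟩
      0# + (x - y)            ≈⟨ +-identityˡ (x - y) ⟩
      x - y                   ∎

  ⟦⊖⟧ : ∀ m n → ⟦ m ⊖ n ⟧ ≈ m ×′ 1# - n ×′ 1#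
  ⟦⊖⟧ zero zero = x≈x-0 0#
  ⟦⊖⟧ zero (suc n) = x≈0+x _
  ⟦⊖⟧ (suc m) zero = x≈x-0 _
  ⟦⊖⟧ (suc m) (suc n) = begin
    ⟦ suc m ⊖ suc n ⟧                 ≡⟨ ≡.cong ⟦_⟧ (ℤP.[1+m]⊖[1+n]≡m⊖n m n) ⟩
    ⟦ m ⊖ n ⟧                         ≈⟨ ⟦⊖⟧ m n ⟩
    m ×′ 1# - n ×′ 1#                 ≈⟨ [1+x]-[1+y]≈x-y _ _ ⟨
    (1# + m ×′ 1#) - (1# + n ×′ 1#)   ≈⟨ +-cong (1+× m 1#) (-‿cong (1+× n 1#)) ⟨
    suc m ×′ 1# - suc n ×′ 1#         ∎

  ⟦+⟧ : ∀ i j → ⟦ i ℤ.+ j ⟧ ≈ ⟦ i ⟧ + ⟦ j ⟧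
  ⟦+⟧ (+ m) (+ n) = ×-homo-+ 1# m n
  ⟦+⟧ (+ m) -[1+ n ] = ⟦⊖⟧ m (suc n)
  ⟦+⟧ -[1+ m ] (+ n) = trans (⟦⊖⟧ n (suc m)) (+-comm _ _)
  ⟦+⟧ -[1+ m ] -[1+ n ] = begin
    - (suc (suc (m ℕ.+ n)) ×′ 1#)     ≡⟨ ≡.cong (λ k → - (k ×′ 1#)) (ℕP.+-suc (suc m) n) ⟨
    - ((suc m ℕ.+ suc n) ×′ 1#)       ≈⟨ -‿cong (×-homo-+ 1# (suc m) (suc n)) ⟩
    - (suc m ×′ 1# + suc n ×′ 1#)     ≈⟨ ⁻¹-∙-comm _ _ ⟨
    - (suc m ×′ 1#) + - (suc n ×′ 1#) ∎

  ⟦-⟧ : ∀ i → ⟦ ℤ.- i ⟧ ≈ - ⟦ i ⟧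
  ⟦-⟧ (+ zero) = sym -0#≈0#
  ⟦-⟧ (+ suc n) = refl
  ⟦-⟧ -[1+ n ] = sym (-‿involutive _)

  ⟦◃⟧ : ∀ s n → ⟦ s ℤ.◃ n ⟧ ≈ ⟦ s ⟧ₛ * (n ×′ 1#)
  ⟦◃⟧ s zero = sym (zeroʳ _)
  ⟦◃⟧ Sign.+ (suc n) = sym (*-identityˡ _)
  ⟦◃⟧ Sign.- (suc n) = sym (-1*x≈-x _)

  ⟦⟧-signAbs : ∀ i → ⟦ i ⟧ ≈ ⟦ ℤ.sign i ⟧ₛ * (ℤ.∣ i ∣ ×′ 1#)
  ⟦⟧-signAbs (+ n) = sym (*-identityˡ _)
  ⟦⟧-signAbs -[1+ n ] = sym (-1*x≈-x _)

  ⟦*⟧ₛ : ∀ s t → ⟦ s Sign.* t ⟧ₛ ≈ ⟦ s ⟧ₛ * ⟦ t ⟧ₛ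
  ⟦*⟧ₛ Sign.+ t = sym (*-identityˡ _)
  ⟦*⟧ₛ Sign.- Sign.+ = sym (*-identityʳ _)
  ⟦*⟧ₛ Sign.- Sign.- = trans (sym (-‿involutive 1#)) (sym (-1*x≈-x _))

  ⟦*⟧ : ∀ i j → ⟦ i ℤ.* j ⟧ ≈ ⟦ i ⟧ * ⟦ j ⟧
  ⟦*⟧ i j = begin
    ⟦ s Sign.* t ℤ.◃ ∣i∣ ℕ.* ∣j∣ ⟧
      ≈⟨ ⟦◃⟧ (s Sign.* t) (∣i∣ ℕ.* ∣j∣) ⟩
    ⟦ s Sign.* t ⟧ₛ * ((∣i∣ ℕ.* ∣j∣) ×′ 1#)
      ≈⟨ *-cong (⟦*⟧ₛ s t) (×1-homo-* ∣i∣ ∣j∣) ⟩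
    (⟦ s ⟧ₛ * ⟦ t ⟧ₛ) * ((∣i∣ ×′ 1#) * (∣j∣ ×′ 1#))
      ≈⟨ *-interchange _ _ _ _ ⟩
    (⟦ s ⟧ₛ * (∣i∣ ×′ 1#)) * (⟦ t ⟧ₛ * (∣j∣ ×′ 1#))
      ≈⟨ *-cong (⟦⟧-signAbs i) (⟦⟧-signAbs j) ⟨
    ⟦ i ⟧ * ⟦ j ⟧ ∎
    where
    s t : Sign
    s = ℤ.sign i
    t = ℤ.sign j
    ∣i∣ ∣j∣ : ℕ
    ∣i∣ = ℤ.∣ i ∣
    ∣j∣ = ℤ.∣ j ∣

  homomorphism : ℤ.+-*-rawRing -Raw-AlmostCommutative⟶ fromCommutativeRing R
  homomorphism = record
    { ⟦_⟧    = ⟦_⟧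
    ; +-homo = ⟦+⟧
    ; *-homo = ⟦*⟧
    ; -‿homo = ⟦-⟧
    ; 0-homo = refl
    ; 1-homo = refl
    }

  ⟦⟧-equal? : ∀ i j → Maybe (⟦ i ⟧ ≈ ⟦ j ⟧)
  ⟦⟧-equal? i j with i ℤ.≟ j
  ... | yes ≡.refl = just refl
  ... | no _ = nothing

  open Algebra.Solver.Ring ℤ.+-*-rawRing (fromCommutativeRing R) homomorphism ⟦⟧-equal? public
    using (Polynomial; solve; _:=_; _:+_; _:*_; :-_; _:-_; con)

  :0 :1 : ∀ {n} → Polynomial n
  :0 = con (+ 0)
  :1 = con (+ 1)

module SeriesCalculus {c ℓ} (R : CommutativeRing c ℓ) (inv : ℕ → CommutativeRing.Carrier R) where
  open CommutativeRing R hiding (zero)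
  open Series R inv
  open import Relation.Binary.Reasoning.Setoid setoid
  open import Algebra.Properties.CommutativeSemigroup +-commutativeSemigroup
    using () renaming (interchange to +-interchange)
  open import Algebra.Properties.CommutativeSemigroup *-commutativeSemigroup
    using (x∙yz≈y∙xz)

  sumTo-cong : ∀ n {f g : ℕ → Carrier} → (∀ i → i < n → f i ≈ g i) →
               sumTo n f ≈ sumTo n g
  sumTo-cong zero f≈g = refl
  sumTo-cong (suc n) f≈g =
    +-cong (sumTo-cong n (λ i i<n → f≈g i (ℕP.m<n⇒m<1+n i<n))) (f≈g n ℕP.≤-refl)

  sumTo-zero : ∀ n {f : ℕ → Carrier} → (∀ i → i < n → f i ≈ 0#) → sumTo n f ≈ 0#
  sumTo-zero n f≈0 = trans (sumTo-cong n f≈0) (zeros n)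
    where
    zeros : ∀ n → sumTo n (λ _ → 0#) ≈ 0#
    zeros zero = refl
    zeros (suc n) = trans (+-identityʳ _) (zeros n)

  sumTo-+ : ∀ n (f g : ℕ → Carrier) → sumTo n (λ i → f i + g i) ≈ sumTo n f + sumTo n g
  sumTo-+ zero f g = sym (+-identityˡ 0#)
  sumTo-+ (suc n) f g = trans (+-congʳ (sumTo-+ n f g)) (+-interchange _ _ _ _)

  *-distribˡ-sumTo : ∀ n k (f : ℕ → Carrier) → k * sumTo n f ≈ sumTo n (λ i → k * f i)
  *-distribˡ-sumTo zero k f = zeroʳ k
  *-distribˡ-sumTo (suc n) k f = trans (distribˡ k _ _) (+-congʳ (*-distribˡ-sumTo n k f))

  sumTo-suc : ∀ n (f : ℕ → Carrier) → sumTo (suc n) f ≈ f 0 + sumTo n (λ i → f (suc i))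
  sumTo-suc zero f = +-comm 0# (f 0)
  sumTo-suc (suc n) f = trans (+-congʳ (sumTo-suc n f)) (+-assoc _ _ _)

  sumTo-extend : ∀ {n K} (f : ℕ → Carrier) → n ≤ K → (∀ i → n ≤ i → f i ≈ 0#) →
                 sumTo K f ≈ sumTo n f
  sumTo-extend {n} f n≤K f≈0 = extend (ℕP.≤⇒≤′ n≤K)
    where
    extend : ∀ {K} → n ≤′ K → sumTo K f ≈ sumTo n f
    extend ≤′-refl = refl
    extend (≤′-step {K} n≤′K) =
      trans (+-cong (extend n≤′K) (f≈0 K (ℕP.≤′⇒≤ n≤′K))) (+-identityʳ _)

  ι-+ : ∀ m n → ι (m ℕ.+ n) ≈ ι m + ι n
  ι-+ zero n = sym (+-identityˡ (ι n))
  ι-+ (suc m) n = trans (+-congˡ (ι-+ m n)) (sym (+-assoc 1# (ι m) (ι n)))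

  ι-∸ : ∀ {i n} → i ≤ n → ι n ≈ ι i + ι (n ℕ.∸ i)
  ι-∸ {i} {n} i≤n =
    trans (reflexive (≡.cong ι (≡.sym (ℕP.m+[n∸m]≡n i≤n)))) (ι-+ i (n ℕ.∸ i))

  suc-∸ : ∀ {i n} → i ≤ n → suc n ℕ.∸ i ≡ suc (n ℕ.∸ i)
  suc-∸ = ℕP.+-∸-assoc 1

  Parity-irrelevant : ∀ {n} (p q : Parity n) → p ≡ q
  Parity-irrelevant p q = transport p q ≡.refl
    where
    transport : ∀ {m n} (p : Parity m) (q : Parity n) (e : m ≡ n) → subst Parity e p ≡ q
    transport (even j) (even k) e with double-injective {j} {k} e
    ... | ≡.refl rewrite ℕP.≡-irrelevant e ≡.refl = ≡.refl
    transport (even j) (odd k) e = ⊥-elim (even≢odd j k e)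
    transport (odd j) (even k) e = ⊥-elim (even≢odd k j (≡.sym e))
    transport (odd j) (odd k) e with double-injective {j} {k} (ℕP.suc-injective e)
    ... | ≡.refl rewrite ℕP.≡-irrelevant e ≡.refl = ≡.refl

  binomialSeries-even : ∀ a k → onePlusTSqPow a (k ℕ.+ k) ≡ binom a k
  binomialSeries-even a k =
    ≡.cong (binCoeff a (k ℕ.+ k)) (Parity-irrelevant (parity (k ℕ.+ k)) (even k))

  binomialSeries-odd : ∀ a k → onePlusTSqPow a (suc (k ℕ.+ k)) ≡ 0#
  binomialSeries-odd a k =
    ≡.cong (binCoeff a (suc (k ℕ.+ k))) (Parity-irrelevant (parity (suc (k ℕ.+ k))) (odd k))

  arctan-even : ∀ k → arctanS (k ℕ.+ k) ≡ 0#
  arctan-even k =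
    ≡.cong (arctanCoeff (k ℕ.+ k)) (Parity-irrelevant (parity (k ℕ.+ k)) (even k))

  arctan-odd : ∀ k → arctanS (suc (k ℕ.+ k)) ≡ pow (- 1#) k * inv (k ℕ.+ k)
  arctan-odd k =
    ≡.cong (arctanCoeff (suc (k ℕ.+ k))) (Parity-irrelevant (parity (suc (k ℕ.+ k))) (odd k))

  infix 4 _≋_
  _≋_ : PS → PS → Set ℓ
  A ≋ B = ∀ n → A n ≈ B n

  ≋-refl : ∀ {A} → A ≋ A
  ≋-refl n = refl

  ≋-sym : ∀ {A B} → A ≋ B → B ≋ A
  ≋-sym A≋B n = sym (A≋B n)

  ≋-trans : ∀ {A B C} → A ≋ B → B ≋ C → A ≋ C
  ≋-trans A≋B B≋C n = trans (A≋B n) (B≋C n)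

  𝟘 : PS
  𝟘 _ = 0#

  𝟙 : PS
  𝟙 zero = 1#
  𝟙 (suc n) = 0#

  infixl 6 _⊕_
  _⊕_ : PS → PS → PS
  (A ⊕ B) n = A n + B n

  infixr 7 _⊛_
  _⊛_ : Carrier → PS → PS
  (k ⊛ A) n = k * A n

  infixr 8 t·_
  t·_ : PS → PS
  (t· A) zero = 0#
  (t· A) (suc n) = A n

  ∂ : PS → PS
  ∂ A n = ι (suc n) * A (suc n)

  δ : PS → PS
  δ A = ∂ A ⊕ t· t· ∂ A

  ⊕-cong : ∀ {A A′ B B′} → A ≋ A′ → B ≋ B′ → A ⊕ B ≋ A′ ⊕ B′
  ⊕-cong A≋A′ B≋B′ n = +-cong (A≋A′ n) (B≋B′ n)

  t·-cong : ∀ {A B} → A ≋ B → t· A ≋ t· B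
  t·-cong A≋B zero = refl
  t·-cong A≋B (suc n) = A≋B n

  ·-cong : ∀ {A A′ B B′} → A ≋ A′ → B ≋ B′ → A · B ≋ A′ · B′
  ·-cong A≋A′ B≋B′ n =
    sumTo-cong (suc n) (λ i _ → *-cong (A≋A′ i) (B≋B′ (n ℕ.∸ i)))

  t·-⊕ : ∀ A B → t· (A ⊕ B) ≋ t· A ⊕ t· B
  t·-⊕ A B zero = sym (+-identityʳ 0#)
  t·-⊕ A B (suc n) = refl

  t·-⊛ : ∀ k A → t· (k ⊛ A) ≋ k ⊛ t· A
  t·-⊛ k A zero = sym (zeroʳ k)
  t·-⊛ k A (suc n) = refl

  ·-distribʳ-⊕ : ∀ A B C → (A ⊕ B) · C ≋ A · C ⊕ B · C
  ·-distribʳ-⊕ A B C n =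
    trans (sumTo-cong (suc n) (λ i _ → distribʳ _ _ _)) (sumTo-+ (suc n) _ _)

  ·-distribˡ-⊕ : ∀ A B C → A · (B ⊕ C) ≋ A · B ⊕ A · C
  ·-distribˡ-⊕ A B C n =
    trans (sumTo-cong (suc n) (λ i _ → distribˡ _ _ _)) (sumTo-+ (suc n) _ _)

  ⊛-·-assoc : ∀ k A B → (k ⊛ A) · B ≋ k ⊛ (A · B)
  ⊛-·-assoc k A B n =
    trans (sumTo-cong (suc n) (λ i _ → *-assoc _ _ _)) (sym (*-distribˡ-sumTo (suc n) k _))

  ·-⊛-comm : ∀ k A B → A · (k ⊛ B) ≋ k ⊛ (A · B)
  ·-⊛-comm k A B n =
    trans (sumTo-cong (suc n) (λ i _ → x∙yz≈y∙xz _ _ _)) (sym (*-distribˡ-sumTo (suc n) k _))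

  ·-identityˡ : ∀ B → 𝟙 · B ≋ B
  ·-identityˡ B n = begin
    (𝟙 · B) n
      ≈⟨ sumTo-suc n _ ⟩
    1# * B n + sumTo n (λ i → 0# * B (n ℕ.∸ suc i))
      ≈⟨ +-cong (*-identityˡ _) (sumTo-zero n (λ i _ → zeroˡ _)) ⟩
    B n + 0#
      ≈⟨ +-identityʳ _ ⟩
    B n ∎

  ·-zeroʳ : ∀ A {B} → B ≋ 𝟘 → A · B ≋ 𝟘
  ·-zeroʳ A B≋𝟘 n =
    sumTo-zero (suc n) (λ i _ → trans (*-congˡ (B≋𝟘 (n ℕ.∸ i))) (zeroʳ _))

  t·-·ˡ : ∀ A B → (t· A) · B ≋ t· (A · B)
  t·-·ˡ A B zero = trans (+-identityˡ _) (zeroˡ _)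
  t·-·ˡ A B (suc n) = trans (sumTo-suc (suc n) _) (trans (+-congʳ (zeroˡ _)) (+-identityˡ _))

  t·-·ʳ : ∀ A B → A · (t· B) ≋ t· (A · B)
  t·-·ʳ A B zero = trans (+-identityˡ _) (zeroʳ _)
  t·-·ʳ A B (suc n) = trans (+-cong (sumTo-cong (suc n) shift) last) (+-identityʳ _)
    where
    shift : ∀ i → i < suc n → A i * (t· B) (suc n ℕ.∸ i) ≈ A i * B (n ℕ.∸ i)
    shift i i<1+n =
      reflexive (≡.cong (λ k → A i * (t· B) k) (suc-∸ (ℕP.<⇒≤pred i<1+n)))
    last : A (suc n) * (t· B) (n ℕ.∸ n) ≈ 0#
    last = trans (reflexive (≡.cong (λ k → A (suc n) * (t· B) k) (ℕP.n∸n≡0 n))) (zeroʳ _)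

  t·t·-⊕ : ∀ A B → t· t· (A ⊕ B) ≋ t· t· A ⊕ t· t· B
  t·t·-⊕ A B = ≋-trans (t·-cong (t·-⊕ A B)) (t·-⊕ (t· A) (t· B))

  t·t·-·ˡ : ∀ A B → t· t· (A · B) ≋ (t· t· A) · B
  t·t·-·ˡ A B = ≋-sym (≋-trans (t·-·ˡ (t· A) B) (t·-cong (t·-·ˡ A B)))

  t·t·-·ʳ : ∀ A B → t· t· (A · B) ≋ A · (t· t· B)
  t·t·-·ʳ A B = ≋-sym (≋-trans (t·-·ʳ A (t· B)) (t·-cong (t·-·ʳ A B)))

  ∂-· : ∀ A B → ∂ (A · B) ≋ ∂ A · B ⊕ A · ∂ B
  ∂-· A B n = begin
    ι (suc n) * sumTo (suc (suc n)) f
      ≈⟨ *-distribˡ-sumTo (suc (suc n)) (ι (suc n)) f ⟩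
    sumTo (suc (suc n)) (λ i → ι (suc n) * f i)
      ≈⟨ sumTo-cong (suc (suc n)) split ⟩
    sumTo (suc (suc n)) (λ i → ι i * f i + ι (suc n ℕ.∸ i) * f i)
      ≈⟨ sumTo-+ (suc (suc n)) _ _ ⟩
    sumTo (suc (suc n)) (λ i → ι i * f i) + sumTo (suc (suc n)) (λ i → ι (suc n ℕ.∸ i) * f i)
      ≈⟨ +-cong left right ⟩
    (∂ A · B) n + (A · ∂ B) n ∎
    where
    f : ℕ → Carrier
    f i = A i * B (suc n ℕ.∸ i)
    split : ∀ i → i < suc (suc n) → ι (suc n) * f i ≈ ι i * f i + ι (suc n ℕ.∸ i) * f i
    split i i<2+n = trans (*-congʳ (ι-∸ (ℕP.<⇒≤pred i<2+n))) (distribʳ _ _ _)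
    left : sumTo (suc (suc n)) (λ i → ι i * f i) ≈ (∂ A · B) n
    left = trans (sumTo-suc (suc n) _) (trans (+-congʳ (zeroˡ _)) (trans (+-identityˡ _)
      (sumTo-cong (suc n) (λ i _ → sym (*-assoc _ _ _)))))
    middle : ∀ i → i < suc n → ι (suc n ℕ.∸ i) * f i ≈ A i * ∂ B (n ℕ.∸ i)
    middle i i<1+n =
      trans (reflexive (≡.cong (λ k → ι k * (A i * B k)) (suc-∸ (ℕP.<⇒≤pred i<1+n))))
            (x∙yz≈y∙xz _ _ _)
    last : ι (n ℕ.∸ n) * f (suc n) ≈ 0#
    last = trans (*-congʳ (reflexive (≡.cong ι (ℕP.n∸n≡0 n)))) (zeroˡ _)
    right : sumTo (suc (suc n)) (λ i → ι (suc n ℕ.∸ i) * f i) ≈ (A · ∂ B) n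
    right = trans (+-cong (sumTo-cong (suc n) middle) last) (+-identityʳ _)

  δ-· : ∀ A B → δ (A · B) ≋ δ A · B ⊕ A · δ B
  δ-· A B n = begin
    δ (A · B) n
      ≈⟨ ⊕-cong (∂-· A B) (≋-trans (t·-cong (t·-cong (∂-· A B))) (t·t·-⊕ _ _)) n ⟩
    ((∂ A · B) n + (A · ∂ B) n) + ((t· t· (∂ A · B)) n + (t· t· (A · ∂ B)) n)
      ≈⟨ +-congˡ (+-cong (t·t·-·ˡ (∂ A) B n) (t·t·-·ʳ A (∂ B) n)) ⟩
    ((∂ A · B) n + (A · ∂ B) n) + (((t· t· ∂ A) · B) n + (A · (t· t· ∂ B)) n)
      ≈⟨ +-interchange _ _ _ _ ⟩
    ((∂ A · B) n + ((t· t· ∂ A) · B) n) + ((A · ∂ B) n + (A · (t· t· ∂ B)) n)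
      ≈⟨ +-cong (·-distribʳ-⊕ (∂ A) (t· t· ∂ A) B n)
                (·-distribˡ-⊕ A (∂ B) (t· t· ∂ B) n) ⟨
    (δ A · B ⊕ A · δ B) n ∎

  δ-⊛ : ∀ k A → δ (k ⊛ A) ≋ k ⊛ δ A
  δ-⊛ k A n = begin
    δ (k ⊛ A) n                     ≈⟨ +-cong (∂-⊛ n) t·t·∂-⊛ ⟩
    k * ∂ A n + k * (t· t· ∂ A) n   ≈⟨ distribˡ k _ _ ⟨
    k * δ A n                       ∎
    where
    ∂-⊛ : ∂ (k ⊛ A) ≋ k ⊛ ∂ A
    ∂-⊛ n = x∙yz≈y∙xz _ _ _
    t·t·∂-⊛ : (t· t· ∂ (k ⊛ A)) n ≈ k * (t· t· ∂ A) n
    t·t·∂-⊛ = ≋-trans (t·-cong (≋-trans (t·-cong ∂-⊛) (t·-⊛ k _))) (t·-⊛ k _) n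

  δ-zero : ∀ A → δ A 0 ≈ ι 1 * A 1
  δ-zero A = +-identityʳ _

  δ-suc : ∀ A m → δ A (suc m) ≈ ι (suc (suc m)) * A (suc (suc m)) + ι m * A m
  δ-suc A zero = +-congˡ (sym (zeroˡ (A 0)))
  δ-suc A (suc m) = refl

  δ-local : ∀ n {A B} → (∀ i → i ≤ suc n → A i ≈ B i) → δ A n ≈ δ B n
  δ-local zero A≈B = +-congʳ (*-congˡ (A≈B 1 ℕP.≤-refl))
  δ-local (suc zero) A≈B = +-congʳ (*-congˡ (A≈B 2 ℕP.≤-refl))
  δ-local (suc (suc m)) A≈B =
    +-cong (*-congˡ (A≈B _ ℕP.≤-refl)) (*-congˡ (A≈B (suc m) (ℕP.m≤n+m (suc m) 2)))

  δ-psPow-zero : ∀ A → δ (psPow A 0) ≋ 𝟘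
  δ-psPow-zero A n = trans (+-cong (zeroʳ _) (t·t·∂ n)) (+-identityʳ 0#)
    where
    t·t·∂ : t· t· ∂ (psPow A 0) ≋ 𝟘
    t·t·∂ zero = refl
    t·t·∂ (suc zero) = refl
    t·t·∂ (suc (suc n)) = zeroʳ _

  seriesSum : ℕ → (ℕ → PS) → PS
  seriesSum K F n = sumTo K (λ m → F m n)

  t·-seriesSum : ∀ K F → t· seriesSum K F ≋ seriesSum K (λ m → t· F m)
  t·-seriesSum K F zero = sym (sumTo-zero K (λ _ _ → refl))
  t·-seriesSum K F (suc n) = refl

  ∂-seriesSum : ∀ K F → ∂ (seriesSum K F) ≋ seriesSum K (λ m → ∂ (F m))
  ∂-seriesSum K F n = *-distribˡ-sumTo K (ι (suc n)) _

  δ-seriesSum : ∀ K F → δ (seriesSum K F) ≋ seriesSum K (λ m → δ (F m))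
  δ-seriesSum K F n = begin
    δ (seriesSum K F) n
      ≈⟨ ⊕-cong (∂-seriesSum K F) t·t·∂ n ⟩
    seriesSum K (λ m → ∂ (F m)) n + seriesSum K (λ m → t· t· ∂ (F m)) n
      ≈⟨ sumTo-+ K _ _ ⟨
    seriesSum K (λ m → δ (F m)) n ∎
    where
    t·t·∂ : t· t· ∂ (seriesSum K F) ≋ seriesSum K (λ m → t· t· ∂ (F m))
    t·t·∂ = ≋-trans (t·-cong (≋-trans (t·-cong (∂-seriesSum K F)) (t·-seriesSum K _)))
                    (t·-seriesSum K _)

  psPow-vanishes : ∀ {A} → A 0 ≈ 0# → ∀ m n → n < m → psPow A m n ≈ 0#
  psPow-vanishes {A} A₀≈0 (suc m) n n<1+m = sumTo-zero (suc n) term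
    where
    term : ∀ i → i < suc n → A i * psPow A m (n ℕ.∸ i) ≈ 0#
    term zero _ = trans (*-congʳ A₀≈0) (zeroˡ _)
    term (suc i) 1+i<1+n =
      trans (*-congˡ (psPow-vanishes A₀≈0 m (n ℕ.∸ suc i) n∸[1+i]<m)) (zeroʳ _)
      where
      n∸[1+i]<m : n ℕ.∸ suc i < m
      n∸[1+i]<m = ℕP.<-≤-trans (ℕP.∸-monoʳ-< ℕ.z<s (ℕP.≤-pred 1+i<1+n)) (ℕP.≤-pred n<1+m)

  expPartial : Carrier → PS → ℕ → PS
  expPartial x A K = seriesSum K (λ m → (pow x m * invFact m) ⊛ psPow A m)

  expS-truncation : ∀ x {A} → A 0 ≈ 0# → ∀ {n K} → n < K →
                    expS x A n ≈ expPartial x A K n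
  expS-truncation x A₀≈0 {n} n<K = sym (sumTo-extend _ n<K vanishes)
    where
    vanishes : ∀ m → n < m → pow x m * invFact m * psPow _ m n ≈ 0#
    vanishes m n<m = trans (*-congˡ (psPow-vanishes A₀≈0 m n n<m)) (zeroʳ _)

module DifferentialEquations {c ℓ} (R : CommutativeRing c ℓ) (inv : ℕ → CommutativeRing.Carrier R)
  (inv-correct : ∀ n → CommutativeRing._≈_ R (CommutativeRing._*_ R (Series.ι R inv (suc n)) (inv n))
                                              (CommutativeRing.1# R)) where
  open CommutativeRing R hiding (zero)
  open Series R inv
  open SeriesCalculus R inv
  open IntegerCoefficientRingSolver R
  open import Relation.Binary.Reasoning.Setoid setoid
  open import Algebra.Properties.Ring ring using (-1*x≈-x)
  open import Algebra.Properties.CommutativeSemigroup *-commutativeSemigroup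
    using (x∙yz≈y∙xz)

  ι-*-inv : ∀ k y → ι (suc k) * (inv k * y) ≈ y
  ι-*-inv k y = trans (sym (*-assoc _ _ _)) (trans (*-congʳ (inv-correct k)) (*-identityˡ y))

  ι-cancel : ∀ k {y z} → ι (suc k) * y ≈ ι (suc k) * z → y ≈ z
  ι-cancel k {y} {z} e = begin
    y                         ≈⟨ ι-*-inv k y ⟨
    ι (suc k) * (inv k * y)   ≈⟨ x∙yz≈y∙xz _ _ _ ⟩
    inv k * (ι (suc k) * y)   ≈⟨ *-congˡ e ⟩
    inv k * (ι (suc k) * z)   ≈⟨ x∙yz≈y∙xz _ _ _ ⟩
    ι (suc k) * (inv k * z)   ≈⟨ ι-*-inv k z ⟩
    z                         ∎

  ι-*-invFact : ∀ n → ι (suc n) * invFact (suc n) ≈ invFact n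
  ι-*-invFact n = ι-*-inv n (invFact n)

  ι-*-egf : ∀ d n → ι (suc n) * (d * invFact (suc n)) ≈ d * invFact n
  ι-*-egf d n = trans (x∙yz≈y∙xz _ _ _) (*-congˡ (ι-*-invFact n))

  half+half≈1 : half + half ≈ 1#
  half+half≈1 = trans (solve 1 (λ h → h :+ h := (:1 :+ (:1 :+ :0)) :* h) refl half)
                      (inv-correct 1)

  binom-suc : ∀ a k → ι (suc k) * binom a (suc k) ≈ (a - ι k) * binom a k
  binom-suc a k = begin
    ι (suc k) * ((fallingFact a k * (a - ι k)) * (inv k * invFact k))
      ≈⟨ solve 5 (λ s f d i F → s :* ((f :* d) :* (i :* F)) := d :* (f :* (s :* (i :* F))))
           refl (ι (suc k)) (fallingFact a k) (a - ι k) (inv k) (invFact k) ⟩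
    (a - ι k) * (fallingFact a k * (ι (suc k) * (inv k * invFact k)))
      ≈⟨ *-congˡ (*-congˡ (ι-*-invFact k)) ⟩
    (a - ι k) * binom a k ∎

  2+double : ∀ k → suc (suc (k ℕ.+ k)) ≡ suc k ℕ.+ suc k
  2+double k = ≡.cong suc (≡.sym (ℕP.+-suc k k))

  δ-binomialSeries : ∀ a → δ (onePlusTSqPow a) ≋ (a + a) ⊛ t· onePlusTSqPow a
  δ-binomialSeries a zero = begin
    δ P 0          ≈⟨ δ-zero P ⟩
    ι 1 * P 1      ≈⟨ *-congˡ (reflexive (binomialSeries-odd a 0)) ⟩
    ι 1 * 0#       ≈⟨ zeroʳ _ ⟩
    0#             ≈⟨ zeroʳ _ ⟨
    (a + a) * 0#   ∎
    where
    P : PS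
    P = onePlusTSqPow a
  δ-binomialSeries a (suc m) = trans (δ-suc P m) (coefficient m (parity m))
    where
    P : PS
    P = onePlusTSqPow a
    coefficient : ∀ m → Parity m →
                  ι (suc (suc m)) * P (suc (suc m)) + ι m * P m ≈ (a + a) * P m
    coefficient _ (even k) = begin
      ι (suc (suc (k ℕ.+ k))) * P (suc (suc (k ℕ.+ k))) + ι (k ℕ.+ k) * P (k ℕ.+ k)
        ≈⟨ +-cong (reflexive (≡.cong (λ j → ι j * P j) (2+double k)))
                  (*-cong (ι-+ k k) (reflexive Pₖ)) ⟩
      ι (suc k ℕ.+ suc k) * P (suc k ℕ.+ suc k) + (ι k + ι k) * binom a k
        ≈⟨ +-congʳ (*-cong (ι-+ (suc k) (suc k)) (reflexive (binomialSeries-even a (suc k)))) ⟩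
      (ι (suc k) + ι (suc k)) * binom a (suc k) + (ι k + ι k) * binom a k
        ≈⟨ +-congʳ (trans (distribʳ _ _ _) (+-cong (binom-suc a k) (binom-suc a k))) ⟩
      ((a - ι k) * binom a k + (a - ι k) * binom a k) + (ι k + ι k) * binom a k
        ≈⟨ solve 3 (λ a t b → ((a :- t) :* b :+ (a :- t) :* b) :+ (t :+ t) :* b := (a :+ a) :* b)
             refl a (ι k) (binom a k) ⟩
      (a + a) * binom a k
        ≈⟨ *-congˡ (reflexive Pₖ) ⟨
      (a + a) * P (k ℕ.+ k) ∎
      where
      Pₖ : P (k ℕ.+ k) ≡ binom a k
      Pₖ = binomialSeries-even a k
    coefficient _ (odd k) = begin
      ι (suc (suc (suc (k ℕ.+ k)))) * P (suc (suc (suc (k ℕ.+ k))))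
        + ι (suc (k ℕ.+ k)) * P (suc (k ℕ.+ k))
        ≈⟨ +-cong (*-congˡ (reflexive P₂ₖ₊₃)) (*-congˡ (reflexive (binomialSeries-odd a k))) ⟩
      ι (suc (suc (suc (k ℕ.+ k)))) * 0# + ι (suc (k ℕ.+ k)) * 0#
        ≈⟨ trans (+-cong (zeroʳ _) (zeroʳ _)) (+-identityʳ 0#) ⟩
      0#
        ≈⟨ trans (*-congˡ (reflexive (binomialSeries-odd a k))) (zeroʳ _) ⟨
      (a + a) * P (suc (k ℕ.+ k)) ∎
      where
      P₂ₖ₊₃ : P (suc (suc (suc (k ℕ.+ k)))) ≡ 0#
      P₂ₖ₊₃ = ≡.trans (≡.cong (λ j → P (suc j)) (2+double k)) (binomialSeries-odd a (suc k))

  ι-*-arctan-odd : ∀ k → ι (suc (k ℕ.+ k)) * arctanS (suc (k ℕ.+ k)) ≈ pow (- 1#) k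
  ι-*-arctan-odd k = begin
    ι (suc (k ℕ.+ k)) * arctanS (suc (k ℕ.+ k))
      ≈⟨ *-congˡ (reflexive (arctan-odd k)) ⟩
    ι (suc (k ℕ.+ k)) * (pow (- 1#) k * inv (k ℕ.+ k))
      ≈⟨ x∙yz≈y∙xz _ _ _ ⟩
    pow (- 1#) k * (ι (suc (k ℕ.+ k)) * inv (k ℕ.+ k))
      ≈⟨ *-congˡ (inv-correct (k ℕ.+ k)) ⟩
    pow (- 1#) k * 1#
      ≈⟨ *-identityʳ _ ⟩
    pow (- 1#) k ∎

  δ-arctan : δ arctanS ≋ 𝟙
  δ-arctan zero = trans (δ-zero arctanS) (ι-*-arctan-odd 0)
  δ-arctan (suc m) = trans (δ-suc arctanS m) (coefficient m (parity m))
    where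
    coefficient : ∀ m → Parity m →
                  ι (suc (suc m)) * arctanS (suc (suc m)) + ι m * arctanS m ≈ 0#
    coefficient _ (even k) = begin
      ι (suc (suc (k ℕ.+ k))) * arctanS (suc (suc (k ℕ.+ k))) + ι (k ℕ.+ k) * arctanS (k ℕ.+ k)
        ≈⟨ +-cong (*-congˡ (reflexive A₂ₖ₊₂)) (*-congˡ (reflexive (arctan-even k))) ⟩
      ι (suc (suc (k ℕ.+ k))) * 0# + ι (k ℕ.+ k) * 0#
        ≈⟨ trans (+-cong (zeroʳ _) (zeroʳ _)) (+-identityʳ 0#) ⟩
      0# ∎
      where
      A₂ₖ₊₂ : arctanS (suc (suc (k ℕ.+ k))) ≡ 0#
      A₂ₖ₊₂ = ≡.trans (≡.cong arctanS (2+double k)) (arctan-even (suc k))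
    coefficient _ (odd k) = begin
      ι (suc (suc (suc (k ℕ.+ k)))) * arctanS (suc (suc (suc (k ℕ.+ k))))
        + ι (suc (k ℕ.+ k)) * arctanS (suc (k ℕ.+ k))
        ≈⟨ +-cong (trans (reflexive (≡.cong (λ j → ι (suc j) * arctanS (suc j)) (2+double k)))
                         (ι-*-arctan-odd (suc k)))
                  (ι-*-arctan-odd k) ⟩
      - 1# * pow (- 1#) k + pow (- 1#) k   ≈⟨ +-congʳ (-1*x≈-x _) ⟩
      - pow (- 1#) k + pow (- 1#) k        ≈⟨ -‿inverseˡ _ ⟩
      0#                                   ∎

  δ-psPow : ∀ {A} → δ A ≋ 𝟙 → ∀ m → δ (psPow A (suc m)) ≋ ι (suc m) ⊛ psPow A m
  δ-psPow {A} δA≋𝟙 m n = begin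
    δ (A · psPow A m) n
      ≈⟨ δ-· A (psPow A m) n ⟩
    (δ A · psPow A m) n + (A · δ (psPow A m)) n
      ≈⟨ +-cong (trans (·-cong δA≋𝟙 (≋-refl {psPow A m}) n) (·-identityˡ (psPow A m) n))
                (A·δpsPow m n) ⟩
    psPow A m n + ι m * psPow A m n
      ≈⟨ trans (distribʳ _ _ _) (+-congʳ (*-identityˡ _)) ⟨
    ι (suc m) * psPow A m n ∎
    where
    A·δpsPow : ∀ m → A · δ (psPow A m) ≋ ι m ⊛ psPow A m
    A·δpsPow zero n = trans (·-zeroʳ A (δ-psPow-zero A) n) (sym (zeroˡ _))
    A·δpsPow (suc m) =
      ≋-trans (·-cong (≋-refl {A}) (δ-psPow δA≋𝟙 m)) (·-⊛-comm (ι (suc m)) A (psPow A m))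

  δ-expPartial : ∀ x {A} → δ A ≋ 𝟙 → ∀ K →
                 δ (expPartial x A (suc K)) ≋ x ⊛ expPartial x A K
  δ-expPartial x {A} δA≋𝟙 K n = begin
    δ (expPartial x A (suc K)) n
      ≈⟨ δ-seriesSum (suc K) F n ⟩
    sumTo (suc K) (λ m → δ (F m) n)
      ≈⟨ sumTo-suc K _ ⟩
    δ (F 0) n + sumTo K (λ m → δ (F (suc m)) n)
      ≈⟨ +-cong (trans (δ-⊛ _ (psPow A 0) n) (trans (*-congˡ (δ-psPow-zero A n)) (zeroʳ _)))
                (sumTo-cong K (λ m _ → term m)) ⟩
    0# + sumTo K (λ m → x * F m n)
      ≈⟨ +-identityˡ _ ⟩
    sumTo K (λ m → x * F m n)
      ≈⟨ *-distribˡ-sumTo K x _ ⟨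
    x * expPartial x A K n ∎
    where
    F : ℕ → PS
    F m = (pow x m * invFact m) ⊛ psPow A m
    term : ∀ m → δ (F (suc m)) n ≈ x * F m n
    term m = begin
      δ (F (suc m)) n
        ≈⟨ δ-⊛ _ (psPow A (suc m)) n ⟩
      (x * pow x m) * (inv m * invFact m) * δ (psPow A (suc m)) n
        ≈⟨ *-congˡ (δ-psPow δA≋𝟙 m n) ⟩
      (x * pow x m) * (inv m * invFact m) * (ι (suc m) * psPow A m n)
        ≈⟨ solve 6 (λ x p i F s a → (x :* p) :* (i :* F) :* (s :* a)
                                     := x :* ((p :* (s :* (i :* F))) :* a))
             refl x (pow x m) (inv m) (invFact m) (ι (suc m)) (psPow A m n) ⟩
      x * ((pow x m * (ι (suc m) * invFact (suc m))) * psPow A m n)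
        ≈⟨ *-congˡ (*-congʳ (*-congˡ (ι-*-invFact m))) ⟩
      x * F m n ∎

  δ-expS : ∀ x {A} → A 0 ≈ 0# → δ A ≋ 𝟙 → δ (expS x A) ≋ x ⊛ expS x A
  δ-expS x {A} A₀≈0 δA≋𝟙 n = begin
    δ (expS x A) n                       ≈⟨ δ-local n {expS x A} truncation ⟩
    δ (expPartial x A (suc (suc n))) n   ≈⟨ δ-expPartial x δA≋𝟙 (suc n) n ⟩
    x * expS x A n                       ∎
    where
    truncation : ∀ i → i ≤ suc n → expS x A i ≈ expPartial x A (suc (suc n)) i
    truncation i i≤1+n = expS-truncation x A₀≈0 (ℕ.s≤s i≤1+n)

  δ-uniqueness : ∀ κ x {u v} → δ u ≋ κ ⊛ t· u ⊕ x ⊛ u → δ v ≋ κ ⊛ t· v ⊕ x ⊛ v →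
                 u 0 ≈ v 0 → u ≋ v
  δ-uniqueness κ x {u} {v} δu δv u₀≈v₀ n = proj₁ (agree n)
    where
    leading₀ : ∀ {w} → δ w ≋ κ ⊛ t· w ⊕ x ⊛ w → ι 1 * w 1 ≈ x * w 0
    leading₀ {w} δw =
      trans (sym (δ-zero w)) (trans (δw 0) (trans (+-congʳ (zeroʳ κ)) (+-identityˡ _)))
    leading : ∀ {w} → δ w ≋ κ ⊛ t· w ⊕ x ⊛ w → ∀ m →
              ι (suc (suc m)) * w (suc (suc m)) ≈ (κ * w m + x * w (suc m)) - ι m * w m
    leading {w} δw m = trans (solve 2 (λ y z → y := (y :+ z) :- z) refl _ _)
                             (+-congʳ (trans (sym (δ-suc w m)) (δw (suc m))))
    agree : ∀ n → u n ≈ v n × u (suc n) ≈ v (suc n)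
    agree zero =
      u₀≈v₀ , ι-cancel 0 (trans (leading₀ δu) (trans (*-congˡ u₀≈v₀) (sym (leading₀ δv))))
    agree (suc n) with agree n
    ... | uₙ≈vₙ , uₙ₊₁≈vₙ₊₁ = uₙ₊₁≈vₙ₊₁ , ι-cancel (suc n) (begin
      ι (suc (suc n)) * u (suc (suc n))
        ≈⟨ leading δu n ⟩
      (κ * u n + x * u (suc n)) - ι n * u n
        ≈⟨ +-cong (+-cong (*-congˡ uₙ≈vₙ) (*-congˡ uₙ₊₁≈vₙ₊₁)) (-‿cong (*-congˡ uₙ≈vₙ)) ⟩
      (κ * v n + x * v (suc n)) - ι n * v n
        ≈⟨ leading δv n ⟨
      ι (suc (suc n)) * v (suc (suc n)) ∎)

  δ-egfD : ∀ r x → δ (egfD r x) ≋ ((- r - half) + (- r - half)) ⊛ t· egfD r x ⊕ x ⊛ egfD r x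
  δ-egfD r x zero = begin
    δ (egfD r x) 0
      ≈⟨ δ-zero (egfD r x) ⟩
    ι 1 * (D r x 1 * invFact 1)
      ≈⟨ ι-*-egf (D r x 1) 0 ⟩
    D r x 1 * 1#
      ≈⟨ solve 3 (λ x r κ → (x :* :1 :- :0 :* (:0 :+ (r :+ r)) :* :0) :* :1
                            := κ :* :0 :+ x :* (:1 :* :1)) refl x r _ ⟩
    ((- r - half) + (- r - half)) * 0# + x * egfD r x 0 ∎
  δ-egfD r x (suc m) = begin
    δ (egfD r x) (suc m)
      ≈⟨ δ-suc (egfD r x) m ⟩
    ι (suc (suc m)) * (D₂ * invFact (suc (suc m))) + ι m * (D₀ * F₀)
      ≈⟨ +-congʳ (ι-*-egf D₂ (suc m)) ⟩
    (x * D₁ - s * (s + (r + r)) * D₀) * F₁ + ι m * (D₀ * F₀)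
      ≈⟨ +-congʳ (solve 6 (λ x D₁ s r D₀ F₁ → (x :* D₁ :- s :* (s :+ (r :+ r)) :* D₀) :* F₁
                                              := x :* (D₁ :* F₁) :- (s :+ (r :+ r)) :* (D₀ :* (s :* F₁)))
                   refl x D₁ s r D₀ F₁) ⟩
    x * (D₁ * F₁) - (s + (r + r)) * (D₀ * (s * F₁)) + ι m * (D₀ * F₀)
      ≈⟨ +-congʳ (+-congˡ (-‿cong (*-congˡ (*-congˡ (ι-*-invFact m))))) ⟩
    x * (D₁ * F₁) - ((1# + ι m) + (r + r)) * (D₀ * F₀) + ι m * (D₀ * F₀)
      ≈⟨ solve 5 (λ x u₁ t r u₀ → x :* u₁ :- ((:1 :+ t) :+ (r :+ r)) :* u₀ :+ t :* u₀
                                  := (:- (r :+ r) :- :1) :* u₀ :+ x :* u₁)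
           refl x (D₁ * F₁) (ι m) r (D₀ * F₀) ⟩
    (- (r + r) - 1#) * (D₀ * F₀) + x * (D₁ * F₁)
      ≈⟨ +-congʳ (*-congʳ exponent) ⟩
    ((- r - half) + (- r - half)) * (D₀ * F₀) + x * (D₁ * F₁) ∎
    where
    s F₀ F₁ D₀ D₁ D₂ : Carrier
    s = ι (suc m)
    F₀ = invFact m
    F₁ = invFact (suc m)
    D₀ = D r x m
    D₁ = D r x (suc m)
    -- D₂ unfolds to x * D₁ - s * (s + (r + r)) * D₀, which the second step uses.
    D₂ = D r x (suc (suc m))
    exponent : - (r + r) - 1# ≈ (- r - half) + (- r - half)
    exponent = begin
      - (r + r) - 1#                ≈⟨ +-congˡ (-‿cong half+half≈1) ⟨
      - (r + r) - (half + half)     ≈⟨ solve 2 (λ r h → :- (r :+ r) :- (h :+ h)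
                                                         := (:- r :- h) :+ (:- r :- h)) refl r half ⟩
      (- r - half) + (- r - half)   ∎

  δ-rhs : ∀ a x → let G = onePlusTSqPow a · expS x arctanS in δ G ≋ (a + a) ⊛ t· G ⊕ x ⊛ G
  δ-rhs a x n = begin
    δ (P · E) n
      ≈⟨ δ-· P E n ⟩
    (δ P · E) n + (P · δ E) n
      ≈⟨ +-cong (·-cong (δ-binomialSeries a) (≋-refl {E}) n)
                (·-cong (≋-refl {P}) (δ-expS x refl δ-arctan) n) ⟩
    (((a + a) ⊛ t· P) · E) n + (P · (x ⊛ E)) n
      ≈⟨ +-cong (⊛-·-assoc (a + a) (t· P) E n) (·-⊛-comm x P E n) ⟩
    (a + a) * ((t· P) · E) n + x * (P · E) n
      ≈⟨ +-congʳ (*-congˡ (t·-·ˡ P E n)) ⟩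
    (a + a) * (t· (P · E)) n + x * (P · E) n ∎
    where
    P E : PS
    P = onePlusTSqPow a
    E = expS x arctanS

  egfD≈rhs-at-0 : ∀ r x → egfD r x 0 ≈ rhs r x 0
  egfD≈rhs-at-0 r x = solve 0 (:1 :* :1 := :0 :+ (:1 :* :1) :* (:0 :+ :1 :* :1 :* :1)) refl

theorem3p4 : ∀ {c ℓ} (R : CommutativeRing c ℓ) (inv : ℕ → CommutativeRing.Carrier R)
               → (∀ n → CommutativeRing._≈_ R (CommutativeRing._*_ R (Series.ι R inv (suc n)) (inv n)) (CommutativeRing.1# R))
               → (r x : CommutativeRing.Carrier R) (n : ℕ)
               → CommutativeRing._≈_ R (Series.egfD R inv r x n) (Series.rhs R inv r x n)
theorem3p4 R inv inv-correct r x =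
  δ-uniqueness (a + a) x (δ-egfD r x) (δ-rhs a x) (egfD≈rhs-at-0 r x)
  where
  open CommutativeRing R using (Carrier; _+_; _-_; -_)
  open Series R inv using (half)
  open DifferentialEquations R inv inv-correct
  a : Carrier
  a = - r - half
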